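{- Let $S$ be a function semigroup on a nonempty set $A$ such that for all $a,b\in A$ there are $c\in A$ and $f,g\in S$ with $f(c)=a$ and $g(c)=b$. Then for every $n\geq2$ and all $a_1,\dots,a_n\in A$ there are $c\in A$ and $g_1,\dots,g_n\in S$ such that $g_i(c)=a_i$ for every $i=1,\dots,n$.
   Context: A function semigroup on $A$ is a nonempty subset $S\subseteq A^A$ closed under composition. -}

module Defs where

open import Level using (Level; _⊔_; suc)
open import Data.Product using (Σ; ∃; _×_)
open import Function using (_∘_)

record IsFunctionSemigroup {a ℓ : Level} (A : Set a) (S : (A → A) → Set ℓ) : Set (a ⊔ ℓ) where
  field
    nonempty : ∃ λ f → S f
    closed   : ∀ {f g} → S f → S g → S (f ∘ g)

module Submission where

open import Level using (Level; _⊔_)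
open import Defs
open import Data.Nat using (ℕ; _≥_; zero; suc)
open import Data.Fin using (Fin; zero; suc)
open import Data.Product using (Σ; _×_; _,_)
open import Function using (_∘_)
open import Relation.Binary.PropositionalEquality using (_≡_; trans; cong)

-- Induction on n: if g₂,…,gₙ reach a₂,…,aₙ from c', choose c with f c = a₁ and
-- g c = c'; then f, g₂ ∘ g, …, gₙ ∘ g reach a₁,…,aₙ from c, by closure under ∘.

private
  variable
    a ℓ : Level

module _ {A : Set a} (S : (A → A) → Set ℓ) where

  ReachableFrom : {n : ℕ} → A → (Fin n → A) → Set (a ⊔ ℓ)
  ReachableFrom {n} c as =
    Σ (Fin n → (A → A)) λ gs → (∀ i → S (gs i)) × (∀ i → gs i c ≡ as i)

  JointlyReachable : {n : ℕ} → (Fin n → A) → Set (a ⊔ ℓ)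
  JointlyReachable as = Σ A λ c → ReachableFrom c as

  PairwiseReachable : Set (a ⊔ ℓ)
  PairwiseReachable = ∀ x y → Σ A λ c → Σ (A → A) λ f → Σ (A → A) λ g →
    S f × S g × f c ≡ x × g c ≡ y

  module _ (isSemigroup : IsFunctionSemigroup A S) where
    open IsFunctionSemigroup isSemigroup using (closed)

    reachableFrom-cons : ∀ {n c c' f g} {as : Fin (suc n) → A} →
      S f → f c ≡ as zero → S g → g c ≡ c' → ReachableFrom c' (as ∘ suc) →
      ReachableFrom c as
    reachableFrom-cons {n} {c} {c'} {f} {g} {as}
      sf fc≡a sg gc≡c' (gs , gs∈S , gs-reach) = hs , hs∈S , hs-reach
      where
      hs : Fin (suc n) → A → A
      hs zero    = f
      hs (suc i) = gs i ∘ g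

      hs∈S : ∀ i → S (hs i)
      hs∈S zero    = sf
      hs∈S (suc i) = closed (gs∈S i) sg

      hs-reach : ∀ i → hs i c ≡ as i
      hs-reach zero    = fc≡a
      hs-reach (suc i) = trans (cong (gs i) gc≡c') (gs-reach i)

    jointlyReachable : A → PairwiseReachable → ∀ {n} (as : Fin n → A) →
      JointlyReachable as
    jointlyReachable a₀ pair {zero}  as = a₀ , (λ ()) , (λ ()) , (λ ())
    jointlyReachable a₀ pair {suc n} as
      with c' , reach ← jointlyReachable a₀ pair (as ∘ suc)
      with c , f , g , sf , sg , fc≡a , gc≡c' ← pair (as zero) c'
      = c , reachableFrom-cons sf fc≡a sg gc≡c' reach

mainTheorem17 : (A : Set) (S : (A → A) → Set) → IsFunctionSemigroup A S → A →
    (∀ a b → Σ A λ c → Σ (A → A) λ f → Σ (A → A) λ g → S f × S g × f c ≡ a × g c ≡ b) →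
    (n : ℕ) → n ≥ 2 → (as : Fin n → A) →
    Σ A λ c → Σ (Fin n → (A → A)) λ gs → (∀ i → S (gs i)) × (∀ i → gs i c ≡ as i)
mainTheorem17 A S isSemigroup a₀ pair n _ as =
  jointlyReachable S isSemigroup a₀ pair as
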